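{- Let $G$ be a chordal graph and let $u_0,u_1,v_0,v_1\in V(G)$ be such that for each $i\in\{0,1\}$ the vertices $u_0,u_1,v_i$ are pairwise distinct, $u_iv_i\notin E(G)$, and $G(u_iv_i)$ is chordal. If $G(u_0v_0)(u_1v_1)$ is not chordal, then $K:=N(u_0)\cap N(u_1)\cap N(v_0)\cap N(v_1)$ induces a complete graph, and $G-K$ has two distinct components $A$ and $B$ such that either $u_0,u_1\in A$ and $v_0,v_1\in B$, or $u_0,v_1\in A$ and $u_1,v_0\in B$.
   Context: A graph is chordal if all its induced cycles have length $3$. For a graph $G=(V,E)$ and vertices $x,y$, $G(xy)=(V,E\cup\{xy\})$. $N(x)$ denotes the neighbourhood of $x$ in $G$. -}

module Defs where

open import Data.Nat using (ℕ; zero; suc; _≤_)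
open import Data.Fin using (Fin; toℕ; _≟_)
open import Data.Bool using (Bool; true; false; _∨_; _∧_)
open import Data.Product using (_×_)
open import Data.Sum using (_⊎_)
open import Relation.Nullary using (¬_; yes; no)
open import Data.Empty using (⊥-elim)
open import Relation.Nullary.Decidable using (⌊_⌋)
open import Relation.Binary.PropositionalEquality using (_≡_; refl; cong₂)
open import Function.Definitions using (Injective)
open import Function.Bundles using (_⇔_)

record Graph (n : ℕ) : Set where
  field
    adj   : Fin n → Fin n → Bool
    sym   : ∀ x y → adj x y ≡ adj y x
    irrefl : ∀ x → adj x x ≡ false
open Graph public

Adj : ∀ {n} → Graph n → Fin n → Fin n → Set
Adj G x y = adj G x y ≡ true

addAdj : ∀ {n} → Graph n → Fin n → Fin n → Fin n → Fin n → Bool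
addAdj G x y a b = adj G a b ∨ ((⌊ a ≟ x ⌋ ∧ ⌊ b ≟ y ⌋) ∨ (⌊ a ≟ y ⌋ ∧ ⌊ b ≟ x ⌋))

private
  swap4 : ∀ p q r s → (p ∧ s) ∨ (q ∧ r) ≡ (r ∧ q) ∨ (s ∧ p)
  swap4 false false false false = refl
  swap4 false false false true = refl
  swap4 false false true false = refl
  swap4 false false true true = refl
  swap4 false true false false = refl
  swap4 false true false true = refl
  swap4 false true true false = refl
  swap4 false true true true = refl
  swap4 true false false false = refl
  swap4 true false false true = refl
  swap4 true false true false = refl
  swap4 true false true true = refl
  swap4 true true false false = refl
  swap4 true true false true = refl
  swap4 true true true false = refl
  swap4 true true true true = refl

  addSym : ∀ {n} (G : Graph n) x y a b → addAdj G x y a b ≡ addAdj G x y b a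
  addSym G x y a b = cong₂ _∨_ (Graph.sym G a b) (swap4 ⌊ a ≟ x ⌋ ⌊ a ≟ y ⌋ ⌊ b ≟ x ⌋ ⌊ b ≟ y ⌋)

  addIrr : ∀ {n} (G : Graph n) x y → ¬ x ≡ y → ∀ a → addAdj G x y a a ≡ false
  addIrr G x y x≢y a rewrite irrefl G a with a ≟ x | a ≟ y
  ... | yes refl | yes refl = ⊥-elim (x≢y refl)
  ... | yes refl | no _ = refl
  ... | no _ | yes refl = refl
  ... | no _ | no _ = refl

-- G(xy) = (V, E ∪ {xy}); requires x ≢ y to stay loopless
addEdge : ∀ {n} (G : Graph n) (x y : Fin n) → ¬ x ≡ y → Graph n
addEdge G x y x≢y = record
  { adj = addAdj G x y ; sym = addSym G x y ; irrefl = addIrr G x y x≢y }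

CycAdj : ℕ → ℕ → ℕ → Set
CycAdj k i j = (suc i ≡ j) ⊎ (suc j ≡ i) ⊎ (i ≡ 0 × suc j ≡ k) ⊎ (j ≡ 0 × suc i ≡ k)

InducedCycle : ∀ {n} → Graph n → (k : ℕ) → (Fin k → Fin n) → Set
InducedCycle G k f =
  3 ≤ k × Injective _≡_ _≡_ f × (∀ i j → Adj G (f i) (f j) ⇔ CycAdj k (toℕ i) (toℕ j))

Chordal : ∀ {n} → Graph n → Set
Chordal G = ∀ k f → InducedCycle G k f → k ≡ 3

N : ∀ {n} → Graph n → Fin n → Fin n → Set
N G x y = Adj G x y

data ConnIn {n} (G : Graph n) (P : Fin n → Set) : Fin n → Fin n → Set where
  here : ∀ {x} → P x → ConnIn G P x x
  step : ∀ {x y z} → ConnIn G P x y → Adj G y z → P z → ConnIn G P x z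

SameComponentMinus : ∀ {n} → Graph n → (K : Fin n → Set) → Fin n → Fin n → Set
SameComponentMinus G K x y = ConnIn G (λ z → ¬ K z) x y

{-# OPTIONS --safe #-}

-- An induced cycle of length at least 4 in G(u₀v₀)(u₁v₁) must contain both new edges, since
-- G(u₀v₀) and G(u₁v₁) are chordal. Deleting u₀v₀ from it leaves an induced path of G(u₁v₁)
-- from v₀ to u₀ which passes through u₁v₁. No vertex of this path lies in K, because a vertex
-- of K sees both ends of the path; so the two halves of the path join v₀ and u₀ to the two
-- ends of u₁v₁ in G - K. Moreover u₀ and v₀ are separated by K: a chordless u₀–v₀ path in
-- G - K closes with u₀v₀ to an induced cycle of G(u₀v₀), hence is u₀ w v₀; chordality of
-- G(u₁v₁) forces the common neighbour w of the ends of the path above to see all of it,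
-- in particular u₁ and v₁, so w ∈ K. Finally, two non-adjacent vertices of K would form an
-- induced 4-cycle with u₀ and v₀ in G.

module Submission where

open import Defs hiding (sym)
open import Data.Nat using (ℕ; zero; suc; _≤_; _<_; z≤n; s≤s; s≤s⁻¹; _∸_; _≤?_; _<?_)
import Data.Nat as ℕ
open import Data.Nat.Properties
  using (≤-refl; ≤-trans; <⇒≤; <-irrefl; ≤∧≢⇒<; n≤1+n; m≤n⇒m<n∨m≡n; suc-injective; ∸-cancelˡ-≡; m∸n≤m; n∸n≡0)
open import Data.Fin using (Fin; toℕ; _≟_; fromℕ<) renaming (zero to fzero)
open import Data.Fin.Properties using (any?; injective⇒≤; toℕ-injective; toℕ<n; toℕ-fromℕ<; fromℕ<-injective)
open import Data.Bool using (T; true; _∧_)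
open import Data.Bool.Properties using (T-≡; T-∨; T-∧)
import Data.Bool.Properties as Bool
open import Data.Product using (_×_; _,_; proj₁; Σ; ∃)
import Data.Product as Product
open import Data.Sum using (_⊎_; inj₁; inj₂; [_,_])
import Data.Sum as Sum
open import Data.Sum.Function.Propositional using (_⊎-⇔_)
open import Data.Empty using (⊥-elim)
open import Relation.Nullary using (¬_; Dec; yes; no; contradiction)
open import Relation.Nullary.Decidable using (_⊎-dec_; _×-dec_; ¬?; ⌊_⌋; toWitness; fromWitness; decidable-stable)
import Relation.Nullary.Decidable as Dec
open import Relation.Binary.PropositionalEquality using (_≡_; _≢_; refl; sym; trans; cong; subst; subst₂)
open import Function using (_∘_; id)
open import Function.Bundles using (_⇔_; mk⇔; Equivalence)
open import Function.Construct.Composition using (_⇔-∘_)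
open import Function.Construct.Symmetry using (⇔-sym)

private variable
  n m : ℕ
  a b x y : Fin n
  r : ℕ → Fin n
  H H′ : Graph n

least? : (P : ℕ → Set) → (∀ i → Dec (P i)) → ∀ m →
         (∃ λ i → i ≤ m × P i × (∀ j → j < i → ¬ P j)) ⊎ (∀ i → i ≤ m → ¬ P i)
least? P P? zero with P? 0
... | yes p0 = inj₁ (0 , z≤n , p0 , λ _ ())
... | no ¬p0 = inj₂ λ { .0 z≤n → ¬p0 }
least? P P? (suc m) with least? P P? m
... | inj₁ (i , i≤m , pi , below) = inj₁ (i , ≤-trans i≤m (n≤1+n m) , pi , below)
... | inj₂ none≤m with P? (suc m)
...   | yes p = inj₁ (suc m , ≤-refl , p , λ j j<1+m → none≤m j (s≤s⁻¹ j<1+m))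
...   | no ¬p = inj₂ λ i i≤1+m → [ none≤m i ∘ s≤s⁻¹ , (λ { refl → ¬p }) ] (m≤n⇒m<n∨m≡n i≤1+m)

adj-sym : (H : Graph n) → Adj H a b → Adj H b a
adj-sym {a = a} {b} H = trans (Graph.sym H b a)

adj-irrefl : (H : Graph n) → ¬ Adj H a a
adj-irrefl {a = a} H h with trans (sym (irrefl H a)) h
... | ()

adj⇒≢ : (H : Graph n) → Adj H a b → a ≢ b
adj⇒≢ H h refl = adj-irrefl H h

adj? : (H : Graph n) → ∀ a b → Dec (Adj H a b)
adj? H a b = adj H a b Bool.≟ true

NewEdge : Fin n → Fin n → Fin n → Fin n → Set
NewEdge x y a b = (a ≡ x × b ≡ y) ⊎ (a ≡ y × b ≡ x)

NewEdge-sym : NewEdge x y a b → NewEdge y x a b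
NewEdge-sym = Sum.swap

NewEdge? : ∀ (x y a b : Fin n) → Dec (NewEdge x y a b)
NewEdge? x y a b = (a ≟ x ×-dec b ≟ y) ⊎-dec (a ≟ y ×-dec b ≟ x)

addEdge-adj : (G : Graph n) (x≢y : x ≢ y) →
              Adj (addEdge G x y x≢y) a b ⇔ (Adj G a b ⊎ NewEdge x y a b)
addEdge-adj G _ = (T-≡ ⊎-⇔ ((endpoints ⊎-⇔ endpoints) ⇔-∘ T-∨)) ⇔-∘ (T-∨ ⇔-∘ ⇔-sym T-≡)
  where
  endpoints : ∀ {a b x y : Fin n} → T (⌊ a ≟ x ⌋ ∧ ⌊ b ≟ y ⌋) ⇔ (a ≡ x × b ≡ y)
  endpoints {a = a} {b} {x} {y} =
    mk⇔ (Product.map (toWitness {a? = a ≟ x}) (toWitness {a? = b ≟ y}))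
        (Product.map (fromWitness {a? = a ≟ x}) (fromWitness {a? = b ≟ y}))
    ⇔-∘ T-∧

record EdgeExtension (H′ : Graph n) (x y : Fin n) (H : Graph n) : Set where
  field
    embed    : Adj H′ a b → Adj H a b
    classify : Adj H a b → Adj H′ a b ⊎ NewEdge x y a b
    added    : Adj H x y

  newEdge⇒adj : NewEdge x y a b → Adj H a b
  newEdge⇒adj (inj₁ (refl , refl)) = added
  newEdge⇒adj (inj₂ (refl , refl)) = adj-sym H added

  symmetric : EdgeExtension H′ y x H
  symmetric = record
    { embed = embed ; classify = Sum.map₂ NewEdge-sym ∘ classify ; added = adj-sym H added }

addEdge-extension : (G : Graph n) (x≢y : x ≢ y) → EdgeExtension G x y (addEdge G x y x≢y)
addEdge-extension G x≢y = record
  { embed    = Equivalence.from (addEdge-adj G x≢y) ∘ inj₁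
  ; classify = Equivalence.to (addEdge-adj G x≢y)
  ; added    = Equivalence.from (addEdge-adj G x≢y) (inj₂ (inj₁ (refl , refl))) }

addEdge-addEdge-extension : ∀ {x′ y′ : Fin n} (G : Graph n) (x≢y : x ≢ y) (x′≢y′ : x′ ≢ y′) →
  EdgeExtension (addEdge G x′ y′ x′≢y′) x y (addEdge (addEdge G x y x≢y) x′ y′ x′≢y′)
addEdge-addEdge-extension G x≢y x′≢y′ = record
  { embed    = [ embed G+xy+x′y′ ∘ embed G+xy , newEdge⇒adj G+xy+x′y′ ] ∘ classify G+x′y′
  ; classify = [ [ inj₁ ∘ embed G+x′y′ , inj₂ ] ∘ classify G+xy , inj₁ ∘ newEdge⇒adj G+x′y′ ]
               ∘ classify G+xy+x′y′
  ; added    = embed G+xy+x′y′ (added G+xy) }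
  where
  open EdgeExtension
  G+xy = addEdge-extension G x≢y
  G+x′y′ = addEdge-extension G x′≢y′
  G+xy+x′y′ = addEdge-extension (addEdge G _ _ x≢y) x′≢y′

Consecutive : ℕ → ℕ → Set
Consecutive i j = suc i ≡ j ⊎ suc j ≡ i

Distinct : (ℕ → Fin n) → ℕ → Set
Distinct r m = ∀ i j → i ≤ m → j ≤ m → r i ≡ r j → i ≡ j

-- Paths and cycles are vertex sequences r 0, …, r m; the values of r beyond m are irrelevant,
-- and a ChordlessCycle H r m has length m + 1.
record ChordlessPath (H : Graph n) (r : ℕ → Fin n) (m : ℕ) : Set where
  field
    distinct  : Distinct r m
    chordless : ∀ i j → i ≤ m → j ≤ m → Adj H (r i) (r j) → Consecutive i j
    edge      : ∀ i → suc i ≤ m → Adj H (r i) (r (suc i))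

record ChordlessCycle (H : Graph n) (r : ℕ → Fin n) (m : ℕ) : Set where
  field
    distinct  : Distinct r m
    chordless : ∀ i j → i ≤ m → j ≤ m → Adj H (r i) (r j) → CycAdj (suc m) i j
    edge      : ∀ i → suc i ≤ m → Adj H (r i) (r (suc i))
    closing   : Adj H (r m) (r 0)

  cycAdj⇒adj : ∀ i j → i ≤ m → j ≤ m → CycAdj (suc m) i j → Adj H (r i) (r j)
  cycAdj⇒adj i .(suc i) _ j≤m (inj₁ refl) = edge i j≤m
  cycAdj⇒adj .(suc j) j i≤m _ (inj₂ (inj₁ refl)) = adj-sym H (edge j i≤m)
  cycAdj⇒adj .0 j _ _ (inj₂ (inj₂ (inj₁ (refl , 1+j≡1+m)))) rewrite suc-injective 1+j≡1+m = adj-sym H closing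
  cycAdj⇒adj i .0 _ _ (inj₂ (inj₂ (inj₂ (refl , 1+i≡1+m)))) rewrite suc-injective 1+i≡1+m = closing

  toInducedCycle : 2 ≤ m → InducedCycle H (suc m) (r ∘ toℕ)
  toInducedCycle 2≤m =
    s≤s 2≤m ,
    (λ {i} {j} e → toℕ-injective (distinct (toℕ i) (toℕ j) (bound i) (bound j) e)) ,
    λ i j → mk⇔ (chordless (toℕ i) (toℕ j) (bound i) (bound j))
                (cycAdj⇒adj (toℕ i) (toℕ j) (bound i) (bound j))
    where
    bound : (i : Fin (suc m)) → toℕ i ≤ m
    bound i = s≤s⁻¹ (toℕ<n i)

chordal⇒triangle : Chordal H → ChordlessCycle H r m → 2 ≤ m → m ≡ 2
chordal⇒triangle chordal cycle 2≤m =
  suc-injective (chordal _ _ (ChordlessCycle.toInducedCycle cycle 2≤m))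

chordal⇒no-long-cycle : Chordal H → ChordlessCycle H r m → ¬ 3 ≤ m
chordal⇒no-long-cycle chordal cycle 3≤m with chordal⇒triangle chordal cycle (<⇒≤ 3≤m)
... | refl = <-irrefl refl 3≤m

fromInducedCycle : ∀ k (c : Fin k → Fin n) → InducedCycle H k c →
                   ∃ λ m → Σ (ℕ → Fin n) λ cℕ → ChordlessCycle H cℕ m × suc m ≡ k
fromInducedCycle {H = H} (suc m) c (_ , injective , adj⇔cyc) = m , cℕ , record
  { distinct  = λ i j i≤m j≤m e →
      fromℕ<-injective i j (s≤s i≤m) (s≤s j≤m) (injective (trans (sym (cℕ≡c i≤m)) (trans e (cℕ≡c j≤m))))
  ; chordless = λ i j i≤m j≤m h → subst₂ (CycAdj (suc m)) (toℕ-fromℕ< (s≤s i≤m)) (toℕ-fromℕ< (s≤s j≤m))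
      (Equivalence.to (adj⇔cyc _ _) (subst₂ (Adj H) (cℕ≡c i≤m) (cℕ≡c j≤m) h))
  ; edge      = λ i 1+i≤m → cycAdj⇒adj i (suc i) (<⇒≤ 1+i≤m) 1+i≤m (inj₁ refl)
  ; closing   = cycAdj⇒adj m 0 ≤-refl z≤n (inj₂ (inj₂ (inj₂ (refl , refl))))
  } , refl
  where
  cℕ : ℕ → Fin _
  cℕ i with i <? suc m
  ... | yes i<1+m = c (fromℕ< i<1+m)
  ... | no _ = c fzero

  cℕ≡c : ∀ {i} (i≤m : i ≤ m) → cℕ i ≡ c (fromℕ< (s≤s i≤m))
  cℕ≡c {i} i≤m with i <? suc m
  ... | yes _ = refl
  ... | no i≮1+m = ⊥-elim (i≮1+m (s≤s i≤m))

  cycAdj⇒adj : ∀ i j (i≤m : i ≤ m) (j≤m : j ≤ m) → CycAdj (suc m) i j → Adj H (cℕ i) (cℕ j)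
  cycAdj⇒adj i j i≤m j≤m cyc = subst₂ (Adj H) (sym (cℕ≡c i≤m)) (sym (cℕ≡c j≤m))
    (Equivalence.from (adj⇔cyc _ _)
      (subst₂ (CycAdj (suc m)) (sym (toℕ-fromℕ< (s≤s i≤m))) (sym (toℕ-fromℕ< (s≤s j≤m))) cyc))

next : ℕ → ℕ → ℕ
next m t with t <? m
... | yes _ = suc t
... | no _ = 0

next-< : ∀ {t} → t < m → next m t ≡ suc t
next-< {m} {t} t<m with t <? m
... | yes _ = refl
... | no t≮m = ⊥-elim (t≮m t<m)

next-last : ∀ m → next m m ≡ 0
next-last m with m <? m
... | yes m<m = ⊥-elim (<-irrefl refl m<m)
... | no _ = refl

next-≤ : ∀ {t} → t ≤ m → next m t ≤ m
next-≤ {m} t≤m with m≤n⇒m<n∨m≡n t≤m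
... | inj₁ t<m rewrite next-< t<m = t<m
... | inj₂ refl rewrite next-last m = z≤n

next-injective : ∀ {i j} → i ≤ m → j ≤ m → next m i ≡ next m j → i ≡ j
next-injective {m} i≤m j≤m e with m≤n⇒m<n∨m≡n i≤m | m≤n⇒m<n∨m≡n j≤m
... | inj₁ i<m | inj₁ j<m rewrite next-< i<m | next-< j<m = suc-injective e
... | inj₁ i<m | inj₂ refl rewrite next-< i<m | next-last m with () ← e
... | inj₂ refl | inj₁ j<m rewrite next-< j<m | next-last m with () ← e
... | inj₂ refl | inj₂ refl = refl

CycAdj-sym : ∀ {k i j} → CycAdj k i j → CycAdj k j i
CycAdj-sym (inj₁ e) = inj₂ (inj₁ e)
CycAdj-sym (inj₂ (inj₁ e)) = inj₁ e
CycAdj-sym (inj₂ (inj₂ (inj₁ e))) = inj₂ (inj₂ (inj₂ e))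
CycAdj-sym (inj₂ (inj₂ (inj₂ e))) = inj₂ (inj₂ (inj₁ e))

CycAdj-pred : ∀ {k i j} → CycAdj k (suc i) (suc j) → CycAdj k i j
CycAdj-pred (inj₁ e) = inj₁ (suc-injective e)
CycAdj-pred (inj₂ (inj₁ e)) = inj₂ (inj₁ (suc-injective e))
CycAdj-pred (inj₂ (inj₂ (inj₁ (() , _))))
CycAdj-pred (inj₂ (inj₂ (inj₂ (() , _))))

CycAdj-wrap : ∀ {i} → CycAdj (suc m) (suc i) 0 → CycAdj (suc m) i m
CycAdj-wrap (inj₂ (inj₁ refl)) = inj₂ (inj₂ (inj₁ (refl , refl)))
CycAdj-wrap (inj₂ (inj₂ (inj₂ (refl , e)))) = inj₁ (suc-injective e)

CycAdj-next⁻ : ∀ {i j} → 1 ≤ m → i ≤ m → j ≤ m → CycAdj (suc m) (next m i) (next m j) → CycAdj (suc m) i j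
CycAdj-next⁻ {m} 1≤m i≤m j≤m h with m≤n⇒m<n∨m≡n i≤m | m≤n⇒m<n∨m≡n j≤m
... | inj₁ i<m | inj₁ j<m rewrite next-< i<m | next-< j<m = CycAdj-pred h
... | inj₁ i<m | inj₂ refl rewrite next-< i<m | next-last m = CycAdj-wrap h
... | inj₂ refl | inj₁ j<m rewrite next-< j<m | next-last m = CycAdj-sym (CycAdj-wrap (CycAdj-sym h))
... | inj₂ refl | inj₂ refl rewrite next-last m with 1≤m | h
... | s≤s _ | inj₂ (inj₂ (inj₁ (_ , ())))
... | s≤s _ | inj₂ (inj₂ (inj₂ (_ , ())))

rotate : ChordlessCycle H r m → 1 ≤ m → ChordlessCycle H (r ∘ next m) m
rotate {H = H} {r} {m} c 1≤m = record
  { distinct  = λ i j i≤m j≤m e → next-injective i≤m j≤m (distinct _ _ (next-≤ i≤m) (next-≤ j≤m) e)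
  ; chordless = λ i j i≤m j≤m h → CycAdj-next⁻ 1≤m i≤m j≤m (chordless _ _ (next-≤ i≤m) (next-≤ j≤m) h)
  ; edge      = rotated-edge
  ; closing   = subst₂ (λ i j → Adj H (r i) (r j)) (sym (next-last m)) (sym (next-< 1≤m)) (edge 0 1≤m)
  }
  where
  open ChordlessCycle c
  rotated-edge : ∀ i → suc i ≤ m → Adj H (r (next m i)) (r (next m (suc i)))
  rotated-edge i 1+i≤m with m≤n⇒m<n∨m≡n 1+i≤m
  ... | inj₁ 1+i<m rewrite next-< 1+i≤m | next-< 1+i<m = edge (suc i) 1+i<m
  ... | inj₂ refl rewrite next-< 1+i≤m | next-last (suc i) = closing

Visits : (ℕ → Fin n) → ℕ → Fin n → Set
Visits r m u = ∃ λ t → t ≤ m × r t ≡ u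

visits-or-avoids : ∀ (r : ℕ → Fin n) m u → Visits r m u ⊎ (∀ i → i ≤ m → r i ≢ u)
visits-or-avoids r m u =
  Sum.map₁ (λ (i , i≤m , ri≡u , _) → i , i≤m , ri≡u) (least? (λ i → r i ≡ u) (λ i → r i ≟ u) m)

rotate-to : ∀ {u} i → ChordlessCycle H r m → 1 ≤ m → i ≤ m → Visits r m u →
            Σ (ℕ → Fin n) λ q → ChordlessCycle H q m × q 0 ≡ r i × Visits q m u
rotate-to {r = r} zero c _ _ on = r , c , refl , on
rotate-to {r = r} {m} (suc i) c 1≤m 1+i≤m (t , t≤m , rt≡u)
  with rotate-to i (rotate c 1≤m) 1≤m (<⇒≤ 1+i≤m) (still-on t t≤m rt≡u)
  where
  still-on : ∀ t → t ≤ m → r t ≡ _ → Visits (r ∘ next m) m _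
  still-on zero _ r0≡u = m , ≤-refl , trans (cong r (next-last m)) r0≡u
  still-on (suc t) 1+t≤m rt≡u = t , <⇒≤ 1+t≤m , trans (cong r (next-< 1+t≤m)) rt≡u
... | q , c′ , q0≡ , on = q , c′ , trans q0≡ (cong r (next-< 1+i≤m)) , on

rotate-edge-to-ends : ∀ {u v} → ChordlessCycle H r m → 1 ≤ m → Visits r m u → Visits r m v → Adj H u v →
                      Σ (ℕ → Fin n) λ q → ChordlessCycle H q m × NewEdge u v (q 0) (q m)
rotate-edge-to-ends {H = H} {r} {m} c 1≤m u∈r (j , j≤m , rj≡v) u~v
  with rotate-to j c 1≤m j≤m u∈r
... | q , c′ , q0≡rj , (t , t≤m , qt≡u)
  with ChordlessCycle.chordless c′ t 0 t≤m z≤n (subst₂ (Adj H) (sym qt≡u) (sym (trans q0≡rj rj≡v)) u~v)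
... | inj₂ (inj₁ refl) = q ∘ next m , rotate c′ 1≤m ,
      inj₁ (trans (cong q (next-< 1≤m)) qt≡u , trans (cong q (next-last m)) (trans q0≡rj rj≡v))
... | inj₂ (inj₂ (inj₂ (refl , refl))) = q , c′ , inj₂ (trans q0≡rj rj≡v , qt≡u)
... | inj₂ (inj₂ (inj₁ (refl , refl))) with () ← 1≤m

m∸n≡1+m∸[1+n] : ∀ {m n} → suc n ≤ m → m ∸ n ≡ suc (m ∸ suc n)
m∸n≡1+m∸[1+n] {suc m} {zero} _ = refl
m∸n≡1+m∸[1+n] {suc m} {suc n} (s≤s 1+n≤m) = m∸n≡1+m∸[1+n] 1+n≤m

reverse : ChordlessPath H r m → ChordlessPath H (λ t → r (m ∸ t)) m
reverse {H = H} {r} {m} p = record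
  { distinct  = λ i j i≤m j≤m e → ∸-cancelˡ-≡ i≤m j≤m (distinct _ _ (m∸n≤m m i) (m∸n≤m m j) e)
  ; chordless = λ i j i≤m j≤m h → Sum.swap (Sum.map (mirror i≤m j≤m) (mirror j≤m i≤m)
                                     (chordless _ _ (m∸n≤m m i) (m∸n≤m m j) h))
  ; edge      = reversed-edge
  }
  where
  open ChordlessPath p
  mirror : ∀ {i j} → i ≤ m → j ≤ m → suc (m ∸ i) ≡ m ∸ j → suc j ≡ i
  mirror {i} {j} i≤m j≤m e with m≤n⇒m<n∨m≡n j≤m
  ... | inj₁ j<m = sym (∸-cancelˡ-≡ i≤m j<m (suc-injective (trans e (m∸n≡1+m∸[1+n] j<m))))
  ... | inj₂ refl rewrite n∸n≡0 j with () ← e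
  reversed-edge : ∀ i → suc i ≤ m → Adj H (r (m ∸ i)) (r (m ∸ suc i))
  reversed-edge i 1+i≤m rewrite m∸n≡1+m∸[1+n] 1+i≤m =
    adj-sym H (edge _ (subst (_≤ m) (m∸n≡1+m∸[1+n] 1+i≤m) (m∸n≤m m i)))

prefix : ∀ {k} → ChordlessPath H r m → k ≤ m → ChordlessPath H r k
prefix p k≤m = record
  { distinct  = λ i j i≤k j≤k → distinct i j (≤-trans i≤k k≤m) (≤-trans j≤k k≤m)
  ; chordless = λ i j i≤k j≤k → chordless i j (≤-trans i≤k k≤m) (≤-trans j≤k k≤m)
  ; edge      = λ i 1+i≤k → edge i (≤-trans 1+i≤k k≤m) }
  where open ChordlessPath p

tail : ChordlessPath H r (suc m) → ChordlessPath H (r ∘ suc) m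
tail p = record
  { distinct  = λ i j i≤m j≤m e → suc-injective (distinct (suc i) (suc j) (s≤s i≤m) (s≤s j≤m) e)
  ; chordless = λ i j i≤m j≤m h →
      Sum.map suc-injective suc-injective (chordless (suc i) (suc j) (s≤s i≤m) (s≤s j≤m) h)
  ; edge      = λ i 1+i≤m → edge (suc i) (s≤s 1+i≤m) }
  where open ChordlessPath p

append : (ℕ → Fin n) → ℕ → Fin n → ℕ → Fin n
append r m z i with i ≤? m
... | yes _ = r i
... | no _ = z

module _ {r : ℕ → Fin n} {m : ℕ} {z : Fin n} where

  append-≤ : ∀ {i} → i ≤ m → append r m z i ≡ r i
  append-≤ {i} i≤m with i ≤? m
  ... | yes _ = refl
  ... | no i≰m = ⊥-elim (i≰m i≤m)

  append-last : append r m z (suc m) ≡ z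
  append-last with suc m ≤? m
  ... | yes 1+m≤m = ⊥-elim (<-irrefl refl 1+m≤m)
  ... | no _ = refl

  data AppendView (i : ℕ) : Set where
    earlier : i ≤ m → append r m z i ≡ r i → AppendView i
    final : i ≡ suc m → append r m z i ≡ z → AppendView i

  appendView : ∀ {i} → i ≤ suc m → AppendView i
  appendView i≤1+m with m≤n⇒m<n∨m≡n i≤1+m
  ... | inj₁ i<1+m = earlier (s≤s⁻¹ i<1+m) (append-≤ (s≤s⁻¹ i<1+m))
  ... | inj₂ refl = final refl append-last

  append-distinct : Distinct r m → (∀ i → i ≤ m → r i ≢ z) → Distinct (append r m z) (suc m)
  append-distinct distinct fresh i j i≤ j≤ e with appendView i≤ | appendView j≤
  ... | earlier i≤m ri | earlier j≤m rj = distinct i j i≤m j≤m (trans (sym ri) (trans e rj))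
  ... | earlier i≤m ri | final _ zj = ⊥-elim (fresh i i≤m (trans (sym ri) (trans e zj)))
  ... | final _ zi | earlier j≤m rj = ⊥-elim (fresh j j≤m (trans (sym rj) (trans (sym e) zi)))
  ... | final refl _ | final refl _ = refl

  append-edge : (∀ i → suc i ≤ m → Adj H (r i) (r (suc i))) → Adj H (r m) z →
                ∀ i → suc i ≤ suc m → Adj H (append r m z i) (append r m z (suc i))
  append-edge {H = H} edge last i 1+i≤1+m with appendView 1+i≤1+m
  ... | earlier 1+i≤m r1+i = subst₂ (Adj H) (sym (append-≤ (<⇒≤ 1+i≤m))) (sym r1+i) (edge i 1+i≤m)
  ... | final refl z1+i = subst₂ (Adj H) (sym (append-≤ ≤-refl)) (sym z1+i) last

  append-path : ChordlessPath H r m → (∀ i → i ≤ m → r i ≢ z) →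
                (∀ i → i ≤ m → Adj H (r i) z → i ≡ m) → Adj H (r m) z →
                ChordlessPath H (append r m z) (suc m)
  append-path {H = H} p fresh only-last last = record
    { distinct  = append-distinct distinct fresh
    ; chordless = chordless′
    ; edge      = append-edge {H = H} edge last }
    where
    open ChordlessPath p
    chordless′ : ∀ i j → i ≤ suc m → j ≤ suc m → Adj H (append r m z i) (append r m z j) → Consecutive i j
    chordless′ i j i≤ j≤ h with appendView i≤ | appendView j≤
    ... | earlier i≤m ri | earlier j≤m rj = chordless i j i≤m j≤m (subst₂ (Adj H) ri rj h)
    ... | earlier i≤m ri | final refl zj = inj₁ (cong suc (only-last i i≤m (subst₂ (Adj H) ri zj h)))
    ... | final refl zi | earlier j≤m rj = inj₂ (cong suc (only-last j j≤m (adj-sym H (subst₂ (Adj H) zi rj h))))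
    ... | final refl _ | final refl _ = ⊥-elim (adj-irrefl H h)

  append-cycle : ChordlessPath H r m → (∀ i → i ≤ m → r i ≢ z) →
                 (∀ i → i ≤ m → Adj H (r i) z → i ≡ 0 ⊎ i ≡ m) → Adj H (r m) z → Adj H z (r 0) →
                 ChordlessCycle H (append r m z) (suc m)
  append-cycle {H = H} p fresh only-ends last first = record
    { distinct  = append-distinct distinct fresh
    ; chordless = chordless′
    ; edge      = append-edge {H = H} edge last
    ; closing   = subst₂ (Adj H) (sym append-last) (sym (append-≤ z≤n)) first }
    where
    open ChordlessPath p
    to-z : ∀ i → i ≤ m → Adj H (r i) z → CycAdj (suc (suc m)) i (suc m)
    to-z i i≤m h with only-ends i i≤m h
    ... | inj₁ refl = inj₂ (inj₂ (inj₁ (refl , refl)))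
    ... | inj₂ refl = inj₁ refl
    chordless′ : ∀ i j → i ≤ suc m → j ≤ suc m →
                 Adj H (append r m z i) (append r m z j) → CycAdj (suc (suc m)) i j
    chordless′ i j i≤ j≤ h with appendView i≤ | appendView j≤
    ... | earlier i≤m ri | earlier j≤m rj =
      [ inj₁ , inj₂ ∘ inj₁ ] (chordless i j i≤m j≤m (subst₂ (Adj H) ri rj h))
    ... | earlier i≤m ri | final refl zj = to-z i i≤m (subst₂ (Adj H) ri zj h)
    ... | final refl zi | earlier j≤m rj = CycAdj-sym (to-z j j≤m (adj-sym H (subst₂ (Adj H) zi rj h)))
    ... | final refl _ | final refl _ = ⊥-elim (adj-irrefl H h)

single : ChordlessPath H (λ _ → x) 0
single {H = H} = record
  { distinct = λ { _ _ z≤n z≤n _ → refl } ; chordless = λ _ _ _ _ h → ⊥-elim (adj-irrefl H h) ; edge = λ _ () }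

-- Let r (1 + j) be the first vertex after r 0 seen by w. If j > 0 then w, r 0, …, r (1 + j) is an
-- induced cycle of length at least 4; so w sees r 1 and we recurse on the tail.
adjacent-to-ends⇒adjacent-to-all : ∀ {w} → Chordal H → ChordlessPath H r m → (∀ t → t ≤ m → r t ≢ w) →
                                   Adj H w (r 0) → Adj H w (r m) → ∀ t → t ≤ m → Adj H w (r t)
adjacent-to-ends⇒adjacent-to-all {m = zero} _ _ _ w~r0 _ .0 z≤n = w~r0
adjacent-to-ends⇒adjacent-to-all {H = H} {r} {suc m} {w} chordal p fresh w~r0 w~rm
  with least? (λ j → Adj H w (r (suc j))) (λ j → adj? H w (r (suc j))) m
... | inj₂ none = ⊥-elim (none m ≤-refl w~rm)
... | inj₁ (zero , _ , w~r1 , _) = λ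
  { zero _ → w~r0
  ; (suc t) 1+t≤1+m → adjacent-to-ends⇒adjacent-to-all chordal (tail p) (λ t t≤m → fresh (suc t) (s≤s t≤m))
                        w~r1 w~rm t (s≤s⁻¹ 1+t≤1+m) }
... | inj₁ (suc j , 1+j≤m , w~rj , below) = ⊥-elim (chordal⇒no-long-cycle chordal cycle (s≤s (s≤s (s≤s z≤n))))
  where
  cycle : ChordlessCycle H (append r (suc (suc j)) w) (suc (suc (suc j)))
  cycle = append-cycle (prefix p (s≤s 1+j≤m)) (λ i i≤ → fresh i (≤-trans i≤ (s≤s 1+j≤m)))
    only-ends (adj-sym H w~rj) w~r0
    where
    only-ends : ∀ i → i ≤ suc (suc j) → Adj H (r i) w → i ≡ 0 ⊎ i ≡ suc (suc j)
    only-ends zero _ _ = inj₁ refl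
    only-ends (suc i) i≤ ri~w with m≤n⇒m<n∨m≡n (s≤s⁻¹ i≤)
    ... | inj₁ i<1+j = ⊥-elim (below i i<1+j (adj-sym H ri~w))
    ... | inj₂ refl = inj₂ refl

common-neighbours-adjacent : ∀ {c} → Chordal H → x ≢ y → ¬ Adj H x y →
  Adj H x a → Adj H a y → Adj H x c → Adj H c y → a ≢ c → Adj H a c
common-neighbours-adjacent {H = H} {x} {y} {a} {c} chordal x≢y x≁y x~a a~y x~c c~y a≢c =
  adj-sym H (adjacent-to-ends⇒adjacent-to-all chordal x-a-y c∉ (adj-sym H x~c) c~y 1 (s≤s z≤n))
  where
  x-a : ChordlessPath H (append (λ _ → x) 0 a) 1
  x-a = append-path single (λ { _ z≤n → adj⇒≢ H x~a }) (λ { _ z≤n _ → refl }) x~a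
  x-a-y : ChordlessPath H (append (append (λ _ → x) 0 a) 1 y) 2
  x-a-y = append-path x-a (λ { 0 _ → x≢y ; 1 _ → adj⇒≢ H a~y ; (suc (suc _)) (s≤s ()) })
                          (λ { 0 _ x~y → ⊥-elim (x≁y x~y) ; 1 _ _ → refl ; (suc (suc _)) (s≤s ()) }) a~y
  c∉ : ∀ t → t ≤ 2 → append (append (λ _ → x) 0 a) 1 y t ≢ c
  c∉ 0 _ = adj⇒≢ H x~c
  c∉ 1 _ = a≢c
  c∉ 2 _ = adj⇒≢ H c~y ∘ sym
  c∉ (suc (suc (suc _))) (s≤s (s≤s ()))

no-vertex-adjacent-to-both-ends : ChordlessPath H r m → 3 ≤ m → ∀ t → t ≤ m →
                                  Adj H (r t) (r 0) → ¬ Adj H (r t) (r m)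
no-vertex-adjacent-to-both-ends p 3≤m t t≤m rt~r0 rt~rm
  with ChordlessPath.chordless p t 0 t≤m z≤n rt~r0
... | inj₂ refl with ChordlessPath.chordless p 1 _ t≤m ≤-refl rt~rm | 3≤m
...   | inj₁ refl | s≤s (s≤s ())
...   | inj₂ refl | ()

NewEdge-positions : ∀ {i j k l} → Distinct r m → i ≤ m → j ≤ m → k ≤ m → l ≤ m →
  NewEdge x y (r i) (r j) → NewEdge x y (r k) (r l) → (i ≡ k × j ≡ l) ⊎ (i ≡ l × j ≡ k)
NewEdge-positions distinct i≤ j≤ k≤ l≤ (inj₁ (refl , refl)) (inj₁ (rk≡ri , rl≡rj)) =
  inj₁ (distinct _ _ i≤ k≤ (sym rk≡ri) , distinct _ _ j≤ l≤ (sym rl≡rj))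
NewEdge-positions distinct i≤ j≤ k≤ l≤ (inj₂ (refl , refl)) (inj₂ (rk≡ri , rl≡rj)) =
  inj₁ (distinct _ _ i≤ k≤ (sym rk≡ri) , distinct _ _ j≤ l≤ (sym rl≡rj))
NewEdge-positions distinct i≤ j≤ k≤ l≤ (inj₁ (refl , refl)) (inj₂ (rk≡rj , rl≡ri)) =
  inj₂ (distinct _ _ i≤ l≤ (sym rl≡ri) , distinct _ _ j≤ k≤ (sym rk≡rj))
NewEdge-positions distinct i≤ j≤ k≤ l≤ (inj₂ (refl , refl)) (inj₁ (rk≡rj , rl≡ri)) =
  inj₂ (distinct _ _ i≤ l≤ (sym rl≡ri) , distinct _ _ j≤ k≤ (sym rk≡rj))

NewEdge-step-unique : ∀ {i k} → Distinct r m → suc i ≤ m → suc k ≤ m →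
  NewEdge x y (r i) (r (suc i)) → NewEdge x y (r k) (r (suc k)) → i ≡ k
NewEdge-step-unique distinct 1+i≤m 1+k≤m new new′
  with NewEdge-positions distinct (<⇒≤ 1+i≤m) 1+i≤m (<⇒≤ 1+k≤m) 1+k≤m new new′
... | inj₁ (i≡k , _) = i≡k
... | inj₂ (refl , 1+i≡i) = contradiction 1+i≡i λ ()

module _ {x y : Fin n} (E : EdgeExtension H′ x y H) where
  open EdgeExtension E

  close-path : ChordlessPath H′ r m → NewEdge x y (r 0) (r m) → ChordlessCycle H r m
  close-path {r = r} {m} p ends = record
    { distinct  = distinct
    ; chordless = chordless′
    ; edge      = λ i 1+i≤m → embed (edge i 1+i≤m)
    ; closing   = adj-sym H (newEdge⇒adj ends) }
    where
    open ChordlessPath p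
    chordless′ : ∀ i j → i ≤ m → j ≤ m → Adj H (r i) (r j) → CycAdj (suc m) i j
    chordless′ i j i≤m j≤m h with classify h
    ... | inj₁ h′ = [ inj₁ , inj₂ ∘ inj₁ ] (chordless i j i≤m j≤m h′)
    ... | inj₂ new with NewEdge-positions distinct i≤m j≤m z≤n ≤-refl new ends
    ...   | inj₁ (refl , refl) = inj₂ (inj₂ (inj₁ (refl , refl)))
    ...   | inj₂ (refl , refl) = inj₂ (inj₂ (inj₂ (refl , refl)))

  open-cycle : ¬ Adj H′ x y → ChordlessCycle H r m → NewEdge x y (r 0) (r m) → 2 ≤ m → ChordlessPath H′ r m
  open-cycle {r = r} {m} x≁y c ends 2≤m = record
    { distinct  = distinct
    ; chordless = chordless′
    ; edge      = edge′ }
    where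
    open ChordlessCycle c
    new≁ : ∀ {a b} → NewEdge x y a b → ¬ Adj H′ a b
    new≁ (inj₁ (refl , refl)) = x≁y
    new≁ (inj₂ (refl , refl)) = x≁y ∘ adj-sym H′
    ends≁ : ¬ Adj H′ (r 0) (r m)
    ends≁ = new≁ ends
    chordless′ : ∀ i j → i ≤ m → j ≤ m → Adj H′ (r i) (r j) → Consecutive i j
    chordless′ i j i≤m j≤m h with chordless i j i≤m j≤m (embed h)
    ... | inj₁ e = inj₁ e
    ... | inj₂ (inj₁ e) = inj₂ e
    ... | inj₂ (inj₂ (inj₁ (refl , 1+j≡1+m))) rewrite suc-injective 1+j≡1+m = ⊥-elim (ends≁ h)
    ... | inj₂ (inj₂ (inj₂ (refl , 1+i≡1+m))) rewrite suc-injective 1+i≡1+m = ⊥-elim (ends≁ (adj-sym H′ h))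
    edge′ : ∀ i → suc i ≤ m → Adj H′ (r i) (r (suc i))
    edge′ i 1+i≤m with classify (edge i 1+i≤m)
    ... | inj₁ h′ = h′
    ... | inj₂ new with NewEdge-positions distinct (<⇒≤ 1+i≤m) 1+i≤m z≤n ≤-refl new ends
    ...   | inj₁ (refl , refl) = contradiction 2≤m λ { (s≤s ()) }
    ...   | inj₂ (refl , ())

  cycle-avoiding-endpoint : ChordlessCycle H r m → (∀ i → i ≤ m → r i ≢ x) → ChordlessCycle H′ r m
  cycle-avoiding-endpoint {r = r} {m} c x∉ = record
    { distinct  = distinct
    ; chordless = λ i j i≤m j≤m → chordless i j i≤m j≤m ∘ embed
    ; edge      = λ i 1+i≤m → old (<⇒≤ 1+i≤m) 1+i≤m (edge i 1+i≤m)
    ; closing   = old ≤-refl z≤n closing }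
    where
    open ChordlessCycle c
    old : ∀ {i j} → i ≤ m → j ≤ m → Adj H (r i) (r j) → Adj H′ (r i) (r j)
    old i≤m j≤m h with classify h
    ... | inj₁ h′ = h′
    ... | inj₂ (inj₁ (ri≡x , _)) = ⊥-elim (x∉ _ i≤m ri≡x)
    ... | inj₂ (inj₂ (_ , rj≡x)) = ⊥-elim (x∉ _ j≤m rj≡x)

  path-avoiding-new-edge : ChordlessPath H r m → (∀ i → suc i ≤ m → Adj H′ (r i) (r (suc i))) →
                           ChordlessPath H′ r m
  path-avoiding-new-edge p old = record
    { distinct  = distinct
    ; chordless = λ i j i≤m j≤m → chordless i j i≤m j≤m ∘ embed
    ; edge      = old }
    where open ChordlessPath p

module _ {H : Graph n} {P : Fin n → Set} where

  ConnIn-end : ConnIn H P x y → P y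
  ConnIn-end (here py) = py
  ConnIn-end (step _ _ py) = py

  ConnIn-trans : ∀ {z} → ConnIn H P x y → ConnIn H P y z → ConnIn H P x z
  ConnIn-trans c (here _) = c
  ConnIn-trans c (step d y~z pz) = step (ConnIn-trans c d) y~z pz

  ConnIn-sym : ConnIn H P x y → ConnIn H P y x
  ConnIn-sym (here px) = here px
  ConnIn-sym (step c y~z pz) = ConnIn-trans (step (here pz) (adj-sym H y~z) (ConnIn-end c)) (ConnIn-sym c)

  ConnIn-segment : ∀ (r : ℕ → Fin n) {s t} → s ≤ t → (∀ i → s ≤ i → i < t → Adj H (r i) (r (suc i))) →
                   (∀ i → s ≤ i → i ≤ t → P (r i)) → ConnIn H P (r s) (r t)
  ConnIn-segment r {t = zero} z≤n _ inside = here (inside 0 z≤n z≤n)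
  ConnIn-segment r {s} {suc t} s≤1+t edge inside with m≤n⇒m<n∨m≡n s≤1+t
  ... | inj₂ refl = here (inside s ≤-refl ≤-refl)
  ... | inj₁ (s≤s s≤t) =
    step (ConnIn-segment r s≤t (λ i s≤i i<t → edge i s≤i (≤-trans i<t (n≤1+n t)))
                               (λ i s≤i i≤t → inside i s≤i (≤-trans i≤t (n≤1+n t))))
         (edge t s≤t ≤-refl)
         (inside (suc t) (≤-trans s≤t (n≤1+n t)) ≤-refl)

  record ChordlessPathIn (x y : Fin n) : Set where
    field
      length : ℕ
      vertex : ℕ → Fin n
      path   : ChordlessPath H vertex length
      start  : vertex 0 ≡ x
      end    : vertex length ≡ y
      inside : ∀ t → t ≤ length → P (vertex t)

  -- The path to y is extended by z after being cut at its first vertex equal or adjacent to z.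
  ConnIn⇒ChordlessPathIn : ConnIn H P x y → ChordlessPathIn x y
  ConnIn⇒ChordlessPathIn {x} (here px) = record
    { length = 0 ; vertex = λ _ → x ; path = single ; start = refl ; end = refl ; inside = λ { _ z≤n → px } }
  ConnIn⇒ChordlessPathIn (step {y = y} {z} c y~z pz) with ConnIn⇒ChordlessPathIn c
  ... | record { length = m ; vertex = r ; path = p ; start = r0≡x ; end = rm≡y ; inside = inside }
    with least? (λ f → r f ≡ z ⊎ Adj H (r f) z) (λ f → (r f ≟ z) ⊎-dec adj? H (r f) z) m
  ... | inj₂ none = ⊥-elim (none m ≤-refl (inj₂ (subst (λ v → Adj H v z) (sym rm≡y) y~z)))
  ... | inj₁ (f , f≤m , inj₁ rf≡z , _) = record
    { length = f ; vertex = r ; path = prefix p f≤m ; start = r0≡x ; end = rf≡z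
    ; inside = λ t t≤f → inside t (≤-trans t≤f f≤m) }
  ... | inj₁ (f , f≤m , inj₂ rf~z , below) = record
    { length = suc f
    ; vertex = append r f z
    ; path   = append-path (prefix p f≤m) z∉ only-last rf~z
    ; start  = trans (append-≤ {r = r} {f} {z} z≤n) r0≡x
    ; end    = append-last {r = r} {f} {z}
    ; inside = inside′ }
    where
    z∉ : ∀ i → i ≤ f → r i ≢ z
    z∉ i i≤f ri≡z with m≤n⇒m<n∨m≡n i≤f
    ... | inj₁ i<f = below i i<f (inj₁ ri≡z)
    ... | inj₂ refl = adj⇒≢ H rf~z ri≡z
    only-last : ∀ i → i ≤ f → Adj H (r i) z → i ≡ f
    only-last i i≤f ri~z with m≤n⇒m<n∨m≡n i≤f
    ... | inj₁ i<f = ⊥-elim (below i i<f (inj₂ ri~z))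
    ... | inj₂ i≡f = i≡f
    inside′ : ∀ t → t ≤ suc f → P (append r f z t)
    inside′ t t≤1+f with appendView t≤1+f
    ... | earlier t≤f rt = subst P (sym rt) (inside t (≤-trans t≤f f≤m))
    ... | final _ zt = subst P (sym zt) pz

ChordlessPath-length< : ∀ {n} {H : Graph n} {r m} → ChordlessPath H r m → m < n
ChordlessPath-length< {r = r} p = injective⇒≤ {f = λ (i : Fin (suc _)) → r (toℕ i)}
  (λ {i} {j} → toℕ-injective ∘ ChordlessPath.distinct p (toℕ i) (toℕ j) (s≤s⁻¹ (toℕ<n i)) (s≤s⁻¹ (toℕ<n j)))

module Reachability (H : Graph n) {P : Fin n → Set} (P? : ∀ z → Dec (P z)) (x : Fin n) where

  ReachableWithin : ℕ → Fin n → Set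
  ReachableWithin zero y = x ≡ y × P x
  ReachableWithin (suc t) y = ReachableWithin t y ⊎ (P y × ∃ λ z → ReachableWithin t z × Adj H z y)

  reachableWithin? : ∀ t y → Dec (ReachableWithin t y)
  reachableWithin? zero y = (x ≟ y) ×-dec P? x
  reachableWithin? (suc t) y =
    reachableWithin? t y ⊎-dec (P? y ×-dec any? (λ z → reachableWithin? t z ×-dec adj? H z y))

  reachableWithin⇒ConnIn : ∀ t → ReachableWithin t y → ConnIn H P x y
  reachableWithin⇒ConnIn zero (refl , px) = here px
  reachableWithin⇒ConnIn (suc t) (inj₁ reach) = reachableWithin⇒ConnIn t reach
  reachableWithin⇒ConnIn (suc t) (inj₂ (py , _ , reach , z~y)) = step (reachableWithin⇒ConnIn t reach) z~y py

  reachableWithin-mono : ∀ {s t} → s ≤ t → ReachableWithin s y → ReachableWithin t y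
  reachableWithin-mono {s = zero} {zero} _ reach = reach
  reachableWithin-mono {s = zero} {suc t} _ reach = inj₁ (reachableWithin-mono z≤n reach)
  reachableWithin-mono {s = suc s} {suc t} (s≤s s≤t) (inj₁ reach) = inj₁ (reachableWithin-mono s≤t reach)
  reachableWithin-mono {s = suc s} {suc t} (s≤s s≤t) (inj₂ (py , z , reach , z~y)) =
    inj₂ (py , z , reachableWithin-mono s≤t reach , z~y)

  ConnIn⇒reachableWithin : ConnIn H P x y → ReachableWithin n y
  ConnIn⇒reachableWithin c =
    reachableWithin-mono (<⇒≤ (ChordlessPath-length< path)) (subst (ReachableWithin length) end (along length ≤-refl))
    where
    open ChordlessPathIn (ConnIn⇒ChordlessPathIn c)
    along : ∀ t → t ≤ length → ReachableWithin t (vertex t)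
    along zero _ = sym start , subst P start (inside 0 z≤n)
    along (suc t) 1+t≤ =
      inj₂ (inside (suc t) 1+t≤ , vertex t , along t (<⇒≤ 1+t≤) , ChordlessPath.edge path t 1+t≤)

ConnIn? : (H : Graph n) {P : Fin n → Set} → (∀ z → Dec (P z)) → ∀ x y → Dec (ConnIn H P x y)
ConnIn? {n} H P? x y = Dec.map′ (reachableWithin⇒ConnIn n) ConnIn⇒reachableWithin (reachableWithin? n y)
  where open Reachability H P? x

separated-by-common-neighbours : ∀ {G : Graph n} {K : Fin n → Set} (x≢y : x ≢ y) →
  Chordal (addEdge G x y x≢y) → ¬ Adj G x y → (∀ w → Adj G x w → Adj G w y → K w) →
  ¬ ConnIn G (λ z → ¬ K z) x y
separated-by-common-neighbours {G = G} {K} x≢y chordal x≁y common⇒K c with ConnIn⇒ChordlessPathIn c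
... | record { length = 0 ; start = refl ; end = r0≡y } = x≢y r0≡y
... | record { length = 1 ; path = p ; start = refl ; end = refl } = x≁y (ChordlessPath.edge p 0 ≤-refl)
... | record { length = suc (suc k) ; vertex = r ; path = p ; start = refl ; end = refl ; inside = inside }
  with chordal⇒triangle chordal (close-path (addEdge-extension G x≢y) p (inj₁ (refl , refl))) (s≤s (s≤s z≤n))
... | refl = inside 1 (s≤s z≤n) (common⇒K (r 1) (edge 0 (s≤s z≤n)) (edge 1 ≤-refl))
  where open ChordlessPath p

module TwoEdgeAddition (G : Graph n) {u₀ u₁ v₀ v₁ : Fin n}
  (u₀≢u₁ : u₀ ≢ u₁) (u₀≢v₀ : u₀ ≢ v₀) (u₀≢v₁ : u₀ ≢ v₁) (u₁≢v₁ : u₁ ≢ v₁) (u₀≁v₀ : ¬ Adj G u₀ v₀)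
  (chordal₀ : Chordal (addEdge G u₀ v₀ u₀≢v₀)) (chordal₁ : Chordal (addEdge G u₁ v₁ u₁≢v₁)) where

  H₀ = addEdge G u₀ v₀ u₀≢v₀
  H₁ = addEdge G u₁ v₁ u₁≢v₁
  H₀₁ = addEdge H₀ u₁ v₁ u₁≢v₁

  G⊂H₀ = addEdge-extension G u₀≢v₀
  G⊂H₁ = addEdge-extension G u₁≢v₁
  H₁⊂H₀₁ = addEdge-addEdge-extension G u₀≢v₀ u₁≢v₁

  open EdgeExtension

  u₀≁v₀-in-H₁ : ¬ Adj H₁ u₀ v₀
  u₀≁v₀-in-H₁ h with classify G⊂H₁ h
  ... | inj₁ h′ = u₀≁v₀ h′
  ... | inj₂ (inj₁ (u₀≡u₁ , _)) = u₀≢u₁ u₀≡u₁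
  ... | inj₂ (inj₂ (u₀≡v₁ , _)) = u₀≢v₁ u₀≡v₁

  K : Fin n → Set
  K w = N G u₀ w × N G u₁ w × N G v₀ w × N G v₁ w

  Separation : Set
  Separation = (C u₀ u₁ × C v₀ v₁ × ¬ C u₀ v₀) ⊎ (C u₀ v₁ × C u₁ v₀ × ¬ C u₀ u₁)
    where C = SameComponentMinus G K

  separation? : Dec Separation
  separation? = (C? u₀ u₁ ×-dec C? v₀ v₁ ×-dec ¬? (C? u₀ v₀)) ⊎-dec (C? u₀ v₁ ×-dec C? u₁ v₀ ×-dec ¬? (C? u₀ u₁))
    where
    C? = ConnIn? G (λ w → ¬? (adj? G u₀ w ×-dec adj? G u₁ w ×-dec adj? G v₀ w ×-dec adj? G v₁ w))

  module _ {R : ℕ → Fin n} {m : ℕ} (p : ChordlessPath H₁ R m)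
           (R0≡v₀ : R 0 ≡ v₀) (Rm≡u₀ : R m ≡ u₀) (3≤m : 3 ≤ m) where
    open ChordlessPath p

    G-neighbour⇒H₁-neighbour : ∀ {a w t} → Adj G a w → R t ≡ a → Adj H₁ w (R t)
    G-neighbour⇒H₁-neighbour a~w refl = embed G⊂H₁ (adj-sym G a~w)

    outside-K : ∀ t → t ≤ m → ¬ K (R t)
    outside-K t t≤m (u₀~ , _ , v₀~ , _) = no-vertex-adjacent-to-both-ends p 3≤m t t≤m
      (G-neighbour⇒H₁-neighbour v₀~ R0≡v₀) (G-neighbour⇒H₁-neighbour u₀~ Rm≡u₀)

    uses-u₁v₁ : ∃ λ a → suc a ≤ m × NewEdge u₁ v₁ (R a) (R (suc a))
    uses-u₁v₁ with least? (λ a → suc a ≤ m × NewEdge u₁ v₁ (R a) (R (suc a)))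
                          (λ a → (suc a ≤? m) ×-dec NewEdge? u₁ v₁ (R a) (R (suc a))) m
    ... | inj₁ (a , _ , used , _) = a , used
    ... | inj₂ unused = ⊥-elim (chordal⇒no-long-cycle chordal₀ cycle 3≤m)
      where
      old : ∀ i → suc i ≤ m → Adj G (R i) (R (suc i))
      old i 1+i≤m =
        [ id , (λ new → ⊥-elim (unused i (<⇒≤ 1+i≤m) (1+i≤m , new))) ] (classify G⊂H₁ (edge i 1+i≤m))
      cycle : ChordlessCycle H₀ R m
      cycle = close-path G⊂H₀ (path-avoiding-new-edge G⊂H₁ p old) (inj₂ (R0≡v₀ , Rm≡u₀))

    module _ {a : ℕ} (1+a≤m : suc a ≤ m) (new : NewEdge u₁ v₁ (R a) (R (suc a))) where

      G-edge : ∀ i → suc i ≤ m → i ≢ a → Adj G (R i) (R (suc i))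
      G-edge i 1+i≤m i≢a =
        [ id , (λ new′ → ⊥-elim (i≢a (NewEdge-step-unique distinct 1+i≤m 1+a≤m new′ new))) ]
          (classify G⊂H₁ (edge i 1+i≤m))

      up-to-a : SameComponentMinus G K (R 0) (R a)
      up-to-a = ConnIn-segment R z≤n
        (λ i _ i<a → G-edge i (≤-trans i<a (<⇒≤ 1+a≤m)) λ { refl → <-irrefl refl i<a })
        (λ i _ i≤a → outside-K i (≤-trans i≤a (<⇒≤ 1+a≤m)))

      from-1+a : SameComponentMinus G K (R (suc a)) (R m)
      from-1+a = ConnIn-segment R 1+a≤m
        (λ i a<i i<m → G-edge i i<m λ { refl → <-irrefl refl a<i })
        (λ i _ i≤m → outside-K i i≤m)

      common-neighbour∈K : ∀ w → Adj G u₀ w → Adj G w v₀ → K w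
      common-neighbour∈K w u₀~w w~v₀ =
        u₀~w , adj-sym G (to-G u₁∈R) , adj-sym G w~v₀ , adj-sym G (to-G v₁∈R)
        where
        w∉R : ∀ t → t ≤ m → R t ≢ w
        w∉R t t≤m refl = no-vertex-adjacent-to-both-ends p 3≤m t t≤m
          (G-neighbour⇒H₁-neighbour (adj-sym G w~v₀) R0≡v₀) (G-neighbour⇒H₁-neighbour u₀~w Rm≡u₀)
        w~R : ∀ t → t ≤ m → Adj H₁ w (R t)
        w~R = adjacent-to-ends⇒adjacent-to-all chordal₁ p w∉R
          (G-neighbour⇒H₁-neighbour (adj-sym G w~v₀) R0≡v₀) (G-neighbour⇒H₁-neighbour u₀~w Rm≡u₀)
        u₁∈R : Visits R m u₁
        u₁∈R = [ (λ (Ra≡u₁ , _) → a , <⇒≤ 1+a≤m , Ra≡u₁) , (λ (_ , R1+a≡u₁) → suc a , 1+a≤m , R1+a≡u₁) ] new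
        v₁∈R : Visits R m v₁
        v₁∈R = [ (λ (_ , R1+a≡v₁) → suc a , 1+a≤m , R1+a≡v₁) , (λ (Ra≡v₁ , _) → a , <⇒≤ 1+a≤m , Ra≡v₁) ] new
        w≢ : ∀ {z} → Visits R m z → w ≢ z
        w≢ (t , t≤m , refl) w≡Rt = w∉R t t≤m (sym w≡Rt)
        to-G : ∀ {z} → Visits R m z → Adj G w z
        to-G (t , t≤m , refl) with classify G⊂H₁ (w~R t t≤m)
        ... | inj₁ w~z = w~z
        ... | inj₂ (inj₁ (w≡u₁ , _)) = ⊥-elim (w≢ u₁∈R w≡u₁)
        ... | inj₂ (inj₂ (w≡v₁ , _)) = ⊥-elim (w≢ v₁∈R w≡v₁)

      u₀-v₀-separated : ¬ SameComponentMinus G K u₀ v₀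
      u₀-v₀-separated = separated-by-common-neighbours u₀≢v₀ chordal₀ u₀≁v₀ common-neighbour∈K

      separation-at : Separation
      separation-at = oriented new
        where
        C = SameComponentMinus G K
        oriented : NewEdge u₁ v₁ (R a) (R (suc a)) → Separation
        oriented (inj₁ (Ra≡u₁ , R1+a≡v₁)) =
          inj₂ (v₁-u₀ , u₁-v₀ , λ u₀-u₁ → u₀-v₀-separated (ConnIn-trans u₀-u₁ u₁-v₀))
          where
          v₁-u₀ = ConnIn-sym (subst₂ C R1+a≡v₁ Rm≡u₀ from-1+a)
          u₁-v₀ = ConnIn-sym (subst₂ C R0≡v₀ Ra≡u₁ up-to-a)
        oriented (inj₂ (Ra≡v₁ , R1+a≡u₁)) =
          inj₁ (ConnIn-sym (subst₂ C R1+a≡u₁ Rm≡u₀ from-1+a) , subst₂ C R0≡v₀ Ra≡v₁ up-to-a , u₀-v₀-separated)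

    path⇒separation : Separation
    path⇒separation with uses-u₁v₁
    ... | _ , 1+a≤m , new = separation-at 1+a≤m new

  module _ {r : ℕ → Fin n} {m : ℕ} (cycle : ChordlessCycle H₀₁ r m) (3≤m : 3 ≤ m) where

    2≤m : 2 ≤ m
    2≤m = <⇒≤ 3≤m

    visits-new-end : EdgeExtension H₁ x y H₀₁ → Visits r m x
    visits-new-end {x = x} E with visits-or-avoids r m x
    ... | inj₁ visits = visits
    ... | inj₂ avoids = ⊥-elim (chordal⇒no-long-cycle chordal₁ (cycle-avoiding-endpoint E cycle avoids) 3≤m)

    long-cycle⇒separation : Separation
    long-cycle⇒separation
      with rotate-edge-to-ends cycle (<⇒≤ 2≤m)
             (visits-new-end H₁⊂H₀₁) (visits-new-end (symmetric H₁⊂H₀₁)) (added H₁⊂H₀₁)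
    ... | q , cycle′ , ends@(inj₁ (q0≡u₀ , qm≡v₀)) =
      path⇒separation (reverse (open-cycle H₁⊂H₀₁ u₀≁v₀-in-H₁ cycle′ ends 2≤m))
                      qm≡v₀ (trans (cong q (n∸n≡0 m)) q0≡u₀) 3≤m
    ... | q , cycle′ , ends@(inj₂ (q0≡v₀ , qm≡u₀)) =
      path⇒separation (open-cycle H₁⊂H₀₁ u₀≁v₀-in-H₁ cycle′ ends 2≤m) q0≡v₀ qm≡u₀ 3≤m

  cycle⇒separation : ∀ k c → InducedCycle H₀₁ k c → k ≢ 3 → Separation
  cycle⇒separation k c induced k≢3 with fromInducedCycle {H = H₀₁} k c induced
  ... | m , r , cycle , refl =
    long-cycle⇒separation cycle (≤∧≢⇒< (s≤s⁻¹ (proj₁ induced)) λ { refl → k≢3 refl })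

lemma12 : ∀ {n} (G : Graph n) (u₀ u₁ v₀ v₁ : Fin n) →
    Chordal G →
    (u₀≢u₁ : ¬ u₀ ≡ u₁) →
    (u₀≢v₀ : ¬ u₀ ≡ v₀) → (u₁≢v₀ : ¬ u₁ ≡ v₀) →
    (u₀≢v₁ : ¬ u₀ ≡ v₁) → (u₁≢v₁ : ¬ u₁ ≡ v₁) →
    ¬ Adj G u₀ v₀ → ¬ Adj G u₁ v₁ →
    Chordal (addEdge G u₀ v₀ u₀≢v₀) →
    Chordal (addEdge G u₁ v₁ u₁≢v₁) →
    ¬ Chordal (addEdge (addEdge G u₀ v₀ u₀≢v₀) u₁ v₁ u₁≢v₁) →
    let K = λ w → N G u₀ w × N G u₁ w × N G v₀ w × N G v₁ w in
    (∀ a b → K a → K b → ¬ a ≡ b → Adj G a b) ×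
    ((SameComponentMinus G K u₀ u₁ × SameComponentMinus G K v₀ v₁ ×
        ¬ SameComponentMinus G K u₀ v₀)
     ⊎ (SameComponentMinus G K u₀ v₁ × SameComponentMinus G K u₁ v₀ ×
        ¬ SameComponentMinus G K u₀ u₁))
lemma12 G u₀ u₁ v₀ v₁ chordal u₀≢u₁ u₀≢v₀ _ u₀≢v₁ u₁≢v₁ u₀≁v₀ _ chordal₀ chordal₁ ¬chordal₀₁ =
  K-complete , separation
  where
  open TwoEdgeAddition G u₀≢u₁ u₀≢v₀ u₀≢v₁ u₁≢v₁ u₀≁v₀ chordal₀ chordal₁

  K-complete : ∀ a b → K a → K b → a ≢ b → Adj G a b
  K-complete a b (u₀~a , _ , v₀~a , _) (u₀~b , _ , v₀~b , _) =
    common-neighbours-adjacent {H = G} chordal u₀≢v₀ u₀≁v₀ u₀~a (adj-sym G v₀~a) u₀~b (adj-sym G v₀~b)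

  -- ¬ Chordal provides no cycle constructively, but the conclusion is decidable.
  separation : Separation
  separation with separation?
  ... | yes s = s
  ... | no ¬s = ⊥-elim (¬chordal₀₁ λ k c induced →
                  decidable-stable (k ℕ.≟ 3) (¬s ∘ cycle⇒separation k c induced))
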